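{- For all $n \geq 1$ and every Dyck path $D \in \mathcal{D}_n$, the poset $\psi(D)$ is isomorphic to $\Xi_{\mathrm{poset}}(\Lambda_{\mathrm{steep}}(D))$; that is, $\psi = \Xi_{\mathrm{poset}} \circ \Lambda_{\mathrm{steep}}$ as maps to unit interval posets up to isomorphism.
   Context: A Dyck path of size $n$ is a lattice path of $n$ north steps and $n$ east steps from $(0,0)$ to $(n,n)$ staying weakly above $y=x$; $\mathcal{D}_n$ is the set of these. A plane tree is a rooted tree with the children of each node ordered left to right; $\mathcal{T}_n$ is the set of plane trees with $n$ non-root nodes; the depth of a node is its distance to the root. For a finite set $S = \{x_1 < \cdots < x_n\} \subset \mathbb{R}$, $\preceq_S$ is the partial order on $[n]$ with $i \prec_S j$ iff $x_i + 1 < x_j$. $\Xi_{\mathrm{steep}}: \mathcal{T}_n \to \mathcal{D}_n$: perform the clockwise contour walk of $T$ starting from the top of the root; each time an edge is traversed for the first time append a north step, and for the second time an east step. This is a bijection; $\Lambda_{\mathrm{steep}}$ denotes its inverse. $\Xi_{\mathrm{poset}}$: given $T \in \mathcal{T}_n$ with maximal arity $m$, for a non-root node $w$ let $c(w)=i$ if $w$ is the $i$-th child of its parent counted from right to left. For a non-root node $u$ of depth $d(u)$ with root-to-$u$ path $u_0, \ldots, u_{d(u)} = u$, set $x_u = d(u) + \sum_{i=1}^{d(u)} c(u_i)(m+2)^{ -i}$; with $S$ the set of all $x_u$, $\Xi_{\mathrm{poset}}(T) = ([n], \preceq_S)$. $\psi$: for $D \in \mathcal{D}_n$, its area vector $(a_1,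 \ldots, a_n)$ has $a_i$ equal to the number of full unit squares lying between $D$ and the diagonal $y=x$ whose upper edge lies on the line $y = i$. Then $\psi(D)$ is the poset on $[n]$ with $i \prec j$ iff either $a_i + 2 \leq a_j$, or $a_i + 1 = a_j$ and $i < j$. -}

module Defs where

open import Data.Nat as ℕ using (ℕ; zero; suc; _≤_; _<_; _^_; _⊔_)
open import Data.Nat.Properties using (m^n≢0)
open import Data.Integer using (+_)
open import Data.Rational as ℚ using (ℚ; _/_)
import Data.Rational.Properties as ℚP
open import Data.List using (List; []; _∷_; _++_; length; take; drop; filter)
open import Data.Maybe using (Maybe; just; nothing)
open import Data.Fin using (Fin; toℕ)
open import Data.Product using (Σ; ∃; ∃-syntax; _×_; _,_)
open import Data.Sum using (_⊎_)
open import Function.Bundles using (_↔_; _⇔_; Inverse)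
open import Relation.Binary.PropositionalEquality using (_≡_)
import Data.List.Sort

data Step : Set where
  N E : Step

countN : List Step → ℕ
countN []       = 0
countN (N ∷ w)  = suc (countN w)
countN (E ∷ w)  = countN w

countE : List Step → ℕ
countE []       = 0
countE (N ∷ w)  = countE w
countE (E ∷ w)  = suc (countE w)

record IsDyck (n : ℕ) (w : List Step) : Set where
  field
    northSteps : countN w ≡ n
    eastSteps  : countE w ≡ n
    above      : ∀ k → countE (take k w) ≤ countN (take k w)

-- Plane trees: a node with an ordered (left to right) list of children

data Tree : Set where
  node : List Tree → Tree

mutual
  sizeF : List Tree → ℕ
  sizeF []       = 0
  sizeF (t ∷ ts) = suc (sizeT t) ℕ.+ sizeF ts

  sizeT : Tree → ℕ
  sizeT (node cs) = sizeF cs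

mutual
  maxArityF : List Tree → ℕ
  maxArityF []       = 0
  maxArityF (t ∷ ts) = maxArityT t ⊔ maxArityF ts

  maxArityT : Tree → ℕ
  maxArityT (node cs) = length cs ⊔ maxArityF cs

-- Ξ_steep: clockwise contour walk from the top of the root.
-- Going clockwise, the children of a node are visited from right to left;
-- first traversal of an edge gives N, second traversal gives E.

mutual
  steepF : List Tree → List Step
  steepF []       = []
  steepF (t ∷ ts) = steepF ts ++ (N ∷ steepT t ++ (E ∷ []))

  steepT : Tree → List Step
  steepT (node cs) = steepF cs

Ξsteep : Tree → List Step
Ξsteep = steepT

-- areaGo i e w : i = number of N steps read so far, e = number of E steps
-- read so far.  The row of the (i+1)-th north step (upper edge on y = i+1)
-- starts at x = e, and the full squares between D and the diagonal in that
-- row are the columns e, …, i-1, i.e. there are i ∸ e of them.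
areaGo : ℕ → ℕ → List Step → List ℕ
areaGo i e []      = []
areaGo i e (N ∷ w) = (i ℕ.∸ e) ∷ areaGo (suc i) e w
areaGo i e (E ∷ w) = areaGo i (suc e) w

-- area vector (a₁, …, aₙ), stored 0-indexed
areaVector : List Step → List ℕ
areaVector = areaGo 0 0

_!?_ : {A : Set} → List A → ℕ → Maybe A
[]       !? _     = nothing
(x ∷ xs) !? zero  = just x
(x ∷ xs) !? suc i = xs !? i

-- strict order of ψ(D) on indices (0-indexed: index i stands for i+1)
ψ< : List Step → ℕ → ℕ → Set
ψ< D i j = ∃[ ai ] ∃[ aj ] (areaVector D !? i ≡ just ai × areaVector D !? j ≡ just aj
             × ((ai ℕ.+ 2 ≤ aj) ⊎ ((ai ℕ.+ 1 ≡ aj) × i < j)))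

ψ≼ : List Step → ℕ → ℕ → Set
ψ≼ D i j = i ≡ j ⊎ ψ< D i j

-- coordinates x_u for the non-root nodes of a forest whose members are the
-- children of a node at depth d; acc = Σ_{i=1}^{d} c(u_i)(m+2)^{-i} for
-- that parent.  The first child in a list (t ∷ ts) is the
-- (length (t ∷ ts))-th child counted from right to left.
mutual
  coordsF : (m d : ℕ) → ℚ → List Tree → List ℚ
  coordsF m d acc []       = []
  coordsF m d acc (t ∷ ts) =
    let acc′ = acc ℚ.+ ((+ length (t ∷ ts)) / ((2 ℕ.+ m) ^ suc d)) {{m^n≢0 (2 ℕ.+ m) (suc d)}}
    in ((+ suc d) / 1 ℚ.+ acc′) ∷ coordsT m (suc d) acc′ t ++ coordsF m d acc ts

  coordsT : (m d : ℕ) → ℚ → Tree → List ℚ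
  coordsT m d acc (node cs) = coordsF m d acc cs

coords : Tree → List ℚ
coords T = coordsT (maxArityT T) 0 ℚ.0ℚ T

open Data.List.Sort ℚP.≤-decTotalOrder using (sort)

sortedCoords : Tree → List ℚ
sortedCoords T = sort (coords T)

Ξposet< : Tree → ℕ → ℕ → Set
Ξposet< T i j = ∃[ xi ] ∃[ xj ] (sortedCoords T !? i ≡ just xi × sortedCoords T !? j ≡ just xj
                  × (xi ℚ.+ ℚ.1ℚ) ℚ.< xj)

Ξposet≼ : Tree → ℕ → ℕ → Set
Ξposet≼ T i j = i ≡ j ⊎ Ξposet< T i j

PosetIso : (n : ℕ) → (ℕ → ℕ → Set) → (ℕ → ℕ → Set) → Set
PosetIso n R S = Σ (Fin n ↔ Fin n) λ σ →
  ∀ i j → R (toℕ i) (toℕ j) ⇔ S (toℕ (Inverse.to σ i)) (toℕ (Inverse.to σ j))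

-- Along the contour walk of T, the i-th north step of Ξ_steep T enters a node u, and
-- the row of that step has area d(u) − 1.  Write x_u = d(u) + f_u with 0 < f_u < 1.
-- The walk visits children from right to left, i.e. with increasing digit c, and a
-- digit c ≤ m outweighs all deeper digits because the base is m + 2; so the f_u
-- strictly increase along the walk.  Hence x_u + 1 < x_v holds iff d(u) + 2 ≤ d(v),
-- or d(u) + 1 = d(v) and u comes before v in the walk, which is ψ's relation on the
-- areas.  Sorting S merely relabels, so sending each north step to the position of
-- its node's coordinate in S is the isomorphism.
module Submission where

open import Defs
open import Data.Nat as ℕ using (ℕ; suc; _≤_; _<_; _^_; z≤n; s≤s; NonZero)
import Data.Nat.Properties as ℕP
open import Data.Integer as ℤ using (+_; +≤+; +<+)
import Data.Integer.Properties as ℤP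
open import Data.Integer.Solver using (module +-*-Solver)
open import Data.Rational as ℚ using (ℚ; _/_; toℚᵘ; 0ℚ; 1ℚ)
import Data.Rational.Properties as ℚP
open import Data.Rational.Unnormalised as ℚᵘ using (mkℚᵘ; *≡*; *≤*; *<*)
import Data.Rational.Unnormalised.Properties as ℚᵘP
open import Data.Product using (_×_; _,_; ∃-syntax; proj₁; proj₂)
open import Data.Product.Function.NonDependent.Propositional using (_×-⇔_)
open import Data.Sum using (_⊎_; inj₁; inj₂)
open import Data.Sum.Function.Propositional using (_⊎-⇔_)
open import Data.Empty using (⊥-elim)
open import Data.Maybe using (just)
open import Data.Maybe.Properties using (just-injective)
open import Data.Fin as Fin using (Fin; toℕ)
import Data.Fin.Properties as FinP
open import Data.Fin.Permutation using (Permutation; Permutation′; _⟨$⟩ʳ_; cast-id; _∘ₚ_)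
open import Data.List using (List; []; _∷_; _++_; map; length; lookup)
open import Data.List.Properties using (length-map; map-++; ++-assoc; ++-identityʳ)
open import Data.List.Membership.Propositional.Properties using (∈-lookup)
open import Data.List.Relation.Unary.All as All using (All; []; _∷_)
import Data.List.Relation.Unary.All.Properties as All
open import Data.List.Relation.Unary.AllPairs using (AllPairs; []; _∷_)
import Data.List.Relation.Unary.AllPairs.Properties as AllPairs
open import Data.List.Relation.Binary.Permutation.Propositional
  using (_↭_; ↭⇒↭ₛ; prep; ↭-reflexive; ↭-trans; ↭-sym)
open import Data.List.Relation.Binary.Permutation.Propositional.Properties using (↭-length; ++⁺; ++-comm)
open import Data.List.Relation.Binary.Permutation.Homogeneous using (onIndices)
open import Data.List.Sort ℚP.≤-decTotalOrder using (sort-↭)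
open import Function.Base using (_∘_; _on_)
open import Function.Bundles using (_⇔_; mk⇔; Injection)
import Function.Properties.Equivalence as ⇔
open import Function.Properties.Inverse using (↔⇒↣)
open import Relation.Binary.Definitions using (tri<; tri≈; tri>)
open import Relation.Binary.PropositionalEquality
open import Data.List.Relation.Binary.Permutation.Setoid.Properties (setoid ℚ) using (onIndices-lookup)

toℚᵘ-/ : ∀ k n → toℚᵘ (+ k / suc n) ℚᵘ.≃ mkℚᵘ (+ k) n
toℚᵘ-/ k n = ℚP.toℚᵘ-fromℚᵘ (mkℚᵘ (+ k) n)

*≤*⇒/≤/ : ∀ a b c d .{{_ : NonZero b}} .{{_ : NonZero d}} →
          a ℕ.* d ≤ c ℕ.* b → + a / b ℚ.≤ + c / d
*≤*⇒/≤/ a (suc b) c (suc d) ad≤cb = ℚP.toℚᵘ-cancel-≤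
  (ℚᵘP.≤-respˡ-≃ (ℚᵘP.≃-sym (toℚᵘ-/ a b)) (ℚᵘP.≤-respʳ-≃ (ℚᵘP.≃-sym (toℚᵘ-/ c d))
    (*≤* (subst₂ ℤ._≤_ (ℤP.pos-* a (suc d)) (ℤP.pos-* c (suc b)) (+≤+ ad≤cb)))))

*<*⇒/</ : ∀ a b c d .{{_ : NonZero b}} .{{_ : NonZero d}} →
          a ℕ.* d < c ℕ.* b → + a / b ℚ.< + c / d
*<*⇒/</ a (suc b) c (suc d) ad<cb = ℚP.toℚᵘ-cancel-<
  (ℚᵘP.<-respˡ-≃ (ℚᵘP.≃-sym (toℚᵘ-/ a b)) (ℚᵘP.<-respʳ-≃ (ℚᵘP.≃-sym (toℚᵘ-/ c d))
    (*<* (subst₂ ℤ._<_ (ℤP.pos-* a (suc d)) (ℤP.pos-* c (suc b)) (+<+ ad<cb)))))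

/+/≡/ : ∀ k l b .{{_ : NonZero b}} → + k / b ℚ.+ + l / b ≡ + (k ℕ.+ l) / b
/+/≡/ k l (suc b) = ℚP.toℚᵘ-injective (begin-equality
  toℚᵘ (+ k / suc b ℚ.+ + l / suc b)          ≃⟨ ℚP.toℚᵘ-homo-+ (+ k / suc b) (+ l / suc b) ⟩
  toℚᵘ (+ k / suc b) ℚᵘ.+ toℚᵘ (+ l / suc b)  ≃⟨ ℚᵘP.+-cong (toℚᵘ-/ k b) (toℚᵘ-/ l b) ⟩
  mkℚᵘ (+ k) b ℚᵘ.+ mkℚᵘ (+ l) b              ≃⟨ *≡* numerators ⟩
  mkℚᵘ (+ (k ℕ.+ l)) b                        ≃⟨ ℚᵘP.≃-sym (toℚᵘ-/ (k ℕ.+ l) b) ⟩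
  toℚᵘ (+ (k ℕ.+ l) / suc b)                  ∎)
  where
  open ℚᵘP.≤-Reasoning
  open +-*-Solver
  numerators : (+ k ℤ.* + suc b ℤ.+ + l ℤ.* + suc b) ℤ.* + suc b ≡ + (k ℕ.+ l) ℤ.* + (suc b ℕ.* suc b)
  numerators rewrite ℤP.pos-+ k l | ℤP.pos-* (suc b) (suc b) =
    solve 3 (λ k l β → (k :* β :+ l :* β) :* β := (k :+ l) :* (β :* β)) refl (+ k) (+ l) (+ suc b)

fromℕ : ℕ → ℚ
fromℕ n = + n / 1

fromℕ-+ : ∀ a b → fromℕ (a ℕ.+ b) ≡ fromℕ a ℚ.+ fromℕ b
fromℕ-+ a b = sym (/+/≡/ a b 1)

fromℕ-mono-≤ : ∀ {a b} → a ≤ b → fromℕ a ℚ.≤ fromℕ b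
fromℕ-mono-≤ {a} {b} a≤b = *≤*⇒/≤/ a 1 b 1 (ℕP.*-monoˡ-≤ 1 a≤b)

Frac : ℚ → Set
Frac f = 0ℚ ℚ.≤ f × f ℚ.< 1ℚ

fromℕ+frac<fromℕ-suc : ∀ p {f} → f ℚ.< 1ℚ → fromℕ p ℚ.+ f ℚ.< fromℕ (suc p)
fromℕ+frac<fromℕ-suc p {f} f<1 = begin-strict
  fromℕ p ℚ.+ f   <⟨ ℚP.+-monoʳ-< (fromℕ p) f<1 ⟩
  fromℕ p ℚ.+ 1ℚ  ≡⟨ fromℕ-+ p 1 ⟨
  fromℕ (p ℕ.+ 1) ≡⟨ cong fromℕ (ℕP.+-comm p 1) ⟩
  fromℕ (suc p)   ∎
  where open ℚP.≤-Reasoning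

fromℕ≤fromℕ+frac : ∀ p {f} → 0ℚ ℚ.≤ f → fromℕ p ℚ.≤ fromℕ p ℚ.+ f
fromℕ≤fromℕ+frac p {f} 0≤f = begin
  fromℕ p         ≡⟨ ℚP.+-identityʳ (fromℕ p) ⟨
  fromℕ p ℚ.+ 0ℚ  ≤⟨ ℚP.+-monoʳ-≤ (fromℕ p) 0≤f ⟩
  fromℕ p ℚ.+ f   ∎
  where open ℚP.≤-Reasoning

fromℕ+frac-mono-< : ∀ {p q f g} → Frac f → Frac g → p < q → fromℕ p ℚ.+ f ℚ.< fromℕ q ℚ.+ g
fromℕ+frac-mono-< {p} {q} {f} {g} (_ , f<1) (0≤g , _) p<q = begin-strict
  fromℕ p ℚ.+ f  <⟨ fromℕ+frac<fromℕ-suc p f<1 ⟩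
  fromℕ (suc p)  ≤⟨ fromℕ-mono-≤ p<q ⟩
  fromℕ q        ≤⟨ fromℕ≤fromℕ+frac q 0≤g ⟩
  fromℕ q ℚ.+ g  ∎
  where open ℚP.≤-Reasoning

fromℕ+frac-<-lex : ∀ {p q f g} → Frac f → Frac g →
                   fromℕ p ℚ.+ f ℚ.< fromℕ q ℚ.+ g ⇔ (p < q ⊎ (p ≡ q × f ℚ.< g))
fromℕ+frac-<-lex {p} {q} {f} {g} f∈ g∈ = mk⇔ to from
  where
  to : fromℕ p ℚ.+ f ℚ.< fromℕ q ℚ.+ g → p < q ⊎ (p ≡ q × f ℚ.< g)
  to x<y with ℕP.<-cmp p q
  ... | tri< p<q _ _  = inj₁ p<q
  ... | tri≈ _ refl _ =
    inj₂ (refl , ℚP.≰⇒> (λ g≤f → ℚP.<-irrefl refl (ℚP.<-≤-trans x<y (ℚP.+-monoʳ-≤ (fromℕ p) g≤f))))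
  ... | tri> _ _ q<p  = ⊥-elim (ℚP.<-asym x<y (fromℕ+frac-mono-< g∈ f∈ q<p))
  from : p < q ⊎ (p ≡ q × f ℚ.< g) → fromℕ p ℚ.+ f ℚ.< fromℕ q ℚ.+ g
  from (inj₁ p<q)          = fromℕ+frac-mono-< f∈ g∈ p<q
  from (inj₂ (refl , f<g)) = ℚP.+-monoʳ-< (fromℕ p) f<g

fromℕ+frac+1 : ∀ p f → fromℕ p ℚ.+ f ℚ.+ 1ℚ ≡ fromℕ (suc p) ℚ.+ f
fromℕ+frac+1 p f = begin
  fromℕ p ℚ.+ f ℚ.+ 1ℚ    ≡⟨ ℚP.+-assoc (fromℕ p) f 1ℚ ⟩
  fromℕ p ℚ.+ (f ℚ.+ 1ℚ)  ≡⟨ cong (fromℕ p ℚ.+_) (ℚP.+-comm f 1ℚ) ⟩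
  fromℕ p ℚ.+ (1ℚ ℚ.+ f)  ≡⟨ ℚP.+-assoc (fromℕ p) 1ℚ f ⟨
  fromℕ p ℚ.+ 1ℚ ℚ.+ f    ≡⟨ cong (ℚ._+ f) (fromℕ-+ p 1) ⟨
  fromℕ (p ℕ.+ 1) ℚ.+ f   ≡⟨ cong (λ q → fromℕ q ℚ.+ f) (ℕP.+-comm p 1) ⟩
  fromℕ (suc p) ℚ.+ f     ∎
  where open ≡-Reasoning

AreaPrecedes : ℕ → ℕ → Set → Set
AreaPrecedes a b earlier = a ℕ.+ 2 ≤ b ⊎ (a ℕ.+ 1 ≡ b × earlier)

fromℕ-suc+frac+1-<⇔ : ∀ {a b f g} → Frac f → Frac g →
                      fromℕ (suc a) ℚ.+ f ℚ.+ 1ℚ ℚ.< fromℕ (suc b) ℚ.+ g ⇔ AreaPrecedes a b (f ℚ.< g)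
fromℕ-suc+frac+1-<⇔ {a} {b} {f} {g} f∈ g∈ =
  subst (λ x → x ℚ.< fromℕ (suc b) ℚ.+ g ⇔ AreaPrecedes a b (f ℚ.< g)) (sym (fromℕ+frac+1 (suc a) f))
    (⇔.trans (fromℕ+frac-<-lex f∈ g∈) (gap≥2 ⊎-⇔ (gap≡1 ×-⇔ ⇔.refl)))
  where
  gap≥2 : suc (suc a) < suc b ⇔ a ℕ.+ 2 ≤ b
  gap≥2 = mk⇔ (λ { (s≤s le) → subst (_≤ b) (ℕP.+-comm 2 a) le })
              (λ le → s≤s (subst (_≤ b) (ℕP.+-comm a 2) le))
  gap≡1 : suc (suc a) ≡ suc b ⇔ a ℕ.+ 1 ≡ b
  gap≡1 = mk⇔ (λ e → trans (ℕP.+-comm a 1) (ℕP.suc-injective e))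
              (λ e → cong suc (trans (ℕP.+-comm 1 a) e))

!?-lookup : ∀ {A : Set} (xs : List A) (i : Fin (length xs)) → xs !? toℕ i ≡ just (lookup xs i)
!?-lookup (x ∷ xs) Fin.zero    = refl
!?-lookup (x ∷ xs) (Fin.suc i) = !?-lookup xs i

!?-map-lookup : ∀ {A B : Set} (f : A → B) (xs : List A) (i : Fin (length xs)) →
                map f xs !? toℕ i ≡ just (f (lookup xs i))
!?-map-lookup f (x ∷ xs) Fin.zero    = refl
!?-map-lookup f (x ∷ xs) (Fin.suc i) = !?-map-lookup f xs i

!?-∃⇔ : ∀ {A : Set} (xs : List A) {i j x y} (C : A → A → Set) →
        xs !? i ≡ just x → xs !? j ≡ just y →
        (∃[ x′ ] ∃[ y′ ] (xs !? i ≡ just x′ × xs !? j ≡ just y′ × C x′ y′)) ⇔ C x y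
!?-∃⇔ xs C xs[i] xs[j] = mk⇔
  (λ { (_ , _ , xs[i]′ , xs[j]′ , c) →
       subst₂ C (just-injective (trans (sym xs[i]′) xs[i])) (just-injective (trans (sym xs[j]′) xs[j])) c })
  (λ c → _ , _ , xs[i] , xs[j] , c)

AllPairs-lookup : ∀ {A : Set} {R : A → A → Set} {xs : List A} → AllPairs R xs →
                  ∀ {i j : Fin (length xs)} → toℕ i < toℕ j → R (lookup xs i) (lookup xs j)
AllPairs-lookup (Rx ∷ _)  {Fin.zero}  {Fin.suc j} _         = All.lookup Rx (∈-lookup j)
AllPairs-lookup (_ ∷ Rxs) {Fin.suc i} {Fin.suc j} (s≤s i<j) = AllPairs-lookup Rxs i<j

AllPairs-<-lookup⇔ : ∀ {A : Set} (f : A → ℚ) {xs : List A} → AllPairs (ℚ._<_ on f) xs →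
                     ∀ i j → f (lookup xs i) ℚ.< f (lookup xs j) ⇔ toℕ i < toℕ j
AllPairs-<-lookup⇔ f {xs} xs↗ i j = mk⇔ reflect (AllPairs-lookup xs↗)
  where
  reflect : f (lookup xs i) ℚ.< f (lookup xs j) → toℕ i < toℕ j
  reflect fi<fj with ℕP.<-cmp (toℕ i) (toℕ j)
  ... | tri< i<j _ _ = i<j
  ... | tri≈ _ i≡j _ rewrite FinP.toℕ-injective i≡j = ⊥-elim (ℚP.<-irrefl refl fi<fj)
  ... | tri> _ _ j<i = ⊥-elim (ℚP.<-asym fi<fj (AllPairs-lookup xs↗ j<i))

areaOrder≼ : List ℕ → ℕ → ℕ → Set
areaOrder≼ A i j =
  i ≡ j ⊎ (∃[ ai ] ∃[ aj ] (A !? i ≡ just ai × A !? j ≡ just aj × AreaPrecedes ai aj (i < j)))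

unitIntervalOrder≼ : List ℚ → ℕ → ℕ → Set
unitIntervalOrder≼ S i j =
  i ≡ j ⊎ (∃[ xi ] ∃[ xj ] (S !? i ≡ just xi × S !? j ≡ just xj × xi ℚ.+ 1ℚ ℚ.< xj))

relabel-PosetIso : ∀ {n} (A : List ℕ) (S : List ℚ) (σ : Permutation′ n) {a : Fin n → ℕ} {x : Fin n → ℚ} →
                   (∀ i → A !? toℕ i ≡ just (a i)) → (∀ i → S !? toℕ (σ ⟨$⟩ʳ i) ≡ just (x i)) →
                   (∀ i j → AreaPrecedes (a i) (a j) (toℕ i < toℕ j) ⇔ x i ℚ.+ 1ℚ ℚ.< x j) →
                   PosetIso n (areaOrder≼ A) (unitIntervalOrder≼ S)
relabel-PosetIso A S σ A[i] S[σi] precedes⇔ = σ , λ i j →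
  σ-preserves-≡ i j ⊎-⇔
  ⇔.trans (!?-∃⇔ A (λ a b → AreaPrecedes a b (toℕ i < toℕ j)) (A[i] i) (A[i] j))
    (⇔.trans (precedes⇔ i j) (⇔.sym (!?-∃⇔ S (λ x y → x ℚ.+ 1ℚ ℚ.< y) (S[σi] i) (S[σi] j))))
  where
  σ-preserves-≡ : ∀ i j → toℕ i ≡ toℕ j ⇔ toℕ (σ ⟨$⟩ʳ i) ≡ toℕ (σ ⟨$⟩ʳ j)
  σ-preserves-≡ i j = mk⇔ (λ e → cong (λ k → toℕ (σ ⟨$⟩ʳ k)) (FinP.toℕ-injective e))
                          (λ e → cong toℕ (Injection.injective (↔⇒↣ σ) (FinP.toℕ-injective e)))

-- A label (a, f) describes a node u of depth a + 1 with fractional part f, so x_u = a + 1 + f.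
coordinate : ℕ × ℚ → ℚ
coordinate p = fromℕ (suc (proj₁ p)) ℚ.+ proj₂ p

labels-PosetIso : ∀ (P : List (ℕ × ℚ)) {S : List ℚ} → All (Frac ∘ proj₂) P → AllPairs (ℚ._<_ on proj₂) P →
                  map coordinate P ↭ S → PosetIso (length P) (areaOrder≼ (map proj₁ P)) (unitIntervalOrder≼ S)
labels-PosetIso P {S} fracs increasing P↭S =
  relabel-PosetIso (map proj₁ P) S σ (!?-map-lookup proj₁ P) S[σi] precedes⇔
  where
  X : List ℚ
  X = map coordinate P
  τ : Permutation (length X) (length S)
  τ = onIndices (↭⇒↭ₛ P↭S)
  P→X : length P ≡ length X
  P→X = sym (length-map coordinate P)
  S→P : length S ≡ length P
  S→P = trans (sym (↭-length P↭S)) (length-map coordinate P)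
  σ : Permutation′ (length P)
  σ = cast-id P→X ∘ₚ (τ ∘ₚ cast-id S→P)
  S[σi] : ∀ i → S !? toℕ (σ ⟨$⟩ʳ i) ≡ just (coordinate (lookup P i))
  S[σi] i = begin
    S !? toℕ (σ ⟨$⟩ʳ i)         ≡⟨ cong (S !?_) (FinP.toℕ-cast S→P (τ ⟨$⟩ʳ k)) ⟩
    S !? toℕ (τ ⟨$⟩ʳ k)         ≡⟨ !?-lookup S (τ ⟨$⟩ʳ k) ⟩
    just (lookup S (τ ⟨$⟩ʳ k))  ≡⟨ cong just (onIndices-lookup (↭⇒↭ₛ P↭S) k) ⟨
    just (lookup X k)           ≡⟨ !?-lookup X k ⟨
    X !? toℕ k                  ≡⟨ cong (X !?_) (FinP.toℕ-cast P→X i) ⟩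
    X !? toℕ i                  ≡⟨ !?-map-lookup coordinate P i ⟩
    just (coordinate (lookup P i)) ∎
    where
    open ≡-Reasoning
    k : Fin (length X)
    k = Fin.cast P→X i
  precedes⇔ : ∀ i j → AreaPrecedes (proj₁ (lookup P i)) (proj₁ (lookup P j)) (toℕ i < toℕ j)
                      ⇔ coordinate (lookup P i) ℚ.+ 1ℚ ℚ.< coordinate (lookup P j)
  precedes⇔ i j =
    ⇔.trans (⇔.refl ⊎-⇔ (⇔.refl ×-⇔ ⇔.sym (AllPairs-<-lookup⇔ proj₂ increasing i j)))
            (⇔.sym (fromℕ-suc+frac+1-<⇔ (All.lookup fracs (∈-lookup i)) (All.lookup fracs (∈-lookup j))))

weight : ℕ → ℕ → ℕ
weight m d = (2 ℕ.+ m) ^ suc d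

weight-nonZero : ∀ m d → NonZero (weight m d)
weight-nonZero m d = ℕP.m^n≢0 (2 ℕ.+ m) (suc d)

-- The fractional part of the k-th child (from the right) of a node of depth d with fractional part acc.
childAcc : ℕ → ℕ → ℚ → ℕ → ℚ
childAcc m d acc k = acc ℚ.+ (+ k / weight m d) {{weight-nonZero m d}}

-- The labels of the nodes of a forest of children of a node of depth d, in the
-- order in which the contour walk enters them.
labelsF : (m d : ℕ) → ℚ → List Tree → List (ℕ × ℚ)
labelsF m d acc []             = []
labelsF m d acc (node cs ∷ ts) =
  labelsF m d acc ts ++ (d , acc′) ∷ labelsF m (suc d) acc′ cs
  where
  acc′ : ℚ
  acc′ = childAcc m d acc (suc (length ts))

labelsF-coords-↭ : ∀ m d acc ts → map coordinate (labelsF m d acc ts) ↭ coordsF m d acc ts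
labelsF-coords-↭ m d acc []             = ↭-reflexive refl
labelsF-coords-↭ m d acc (node cs ∷ ts) =
  ↭-trans (↭-reflexive (map-++ coordinate (labelsF m d acc ts) _))
    (↭-trans (++⁺ (labelsF-coords-↭ m d acc ts) (prep _ (labelsF-coords-↭ m (suc d) acc′ cs)))
      (++-comm (coordsF m d acc ts) _))
  where
  acc′ : ℚ
  acc′ = childAcc m d acc (suc (length ts))

length-areaGo : ∀ i e w → length (areaGo i e w) ≡ countN w
length-areaGo i e []      = refl
length-areaGo i e (N ∷ w) = cong suc (length-areaGo (suc i) e w)
length-areaGo i e (E ∷ w) = length-areaGo i (suc e) w

areaGo-steepF : ∀ m d acc ts e w →
                areaGo (d ℕ.+ e) e (steepF ts ++ w) ≡
                map proj₁ (labelsF m d acc ts) ++ areaGo (d ℕ.+ (sizeF ts ℕ.+ e)) (sizeF ts ℕ.+ e) w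
areaGo-steepF m d acc []             e w = refl
areaGo-steepF m d acc (node cs ∷ ts) e w = begin
  areaGo (d ℕ.+ e) e ((steepF ts ++ N ∷ steepF cs ++ E ∷ []) ++ w)
    ≡⟨ cong (areaGo (d ℕ.+ e) e) (trans (++-assoc (steepF ts) _ w)
                                        (cong (λ v → steepF ts ++ N ∷ v) (++-assoc (steepF cs) (E ∷ []) w))) ⟩
  areaGo (d ℕ.+ e) e (steepF ts ++ N ∷ steepF cs ++ E ∷ w)
    ≡⟨ areaGo-steepF m d acc ts e _ ⟩
  areas ts′ ++ (d ℕ.+ e₁ ℕ.∸ e₁) ∷ areaGo (suc d ℕ.+ e₁) e₁ (steepF cs ++ E ∷ w)
    ≡⟨ cong₂ (λ a v → areas ts′ ++ a ∷ v) (ℕP.m+n∸n≡m d e₁) (areaGo-steepF m (suc d) acc′ cs e₁ (E ∷ w)) ⟩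
  areas ts′ ++ d ∷ areas cs′ ++ areaGo (suc d ℕ.+ e₂) (suc e₂) w
    ≡⟨ cong (λ v → areas ts′ ++ d ∷ areas cs′ ++ v) (cong₂ (λ i e → areaGo i e w) climb e₂+1≡e₃) ⟩
  areas ts′ ++ d ∷ areas cs′ ++ rest
    ≡⟨ ++-assoc (areas ts′) (d ∷ areas cs′) rest ⟨
  (areas ts′ ++ d ∷ areas cs′) ++ rest
    ≡⟨ cong (_++ rest) (map-++ proj₁ ts′ _) ⟨
  areas (ts′ ++ (d , acc′) ∷ cs′) ++ rest ∎
  where
  open ≡-Reasoning
  areas : List (ℕ × ℚ) → List ℕ
  areas = map proj₁
  acc′ : ℚ
  acc′ = childAcc m d acc (suc (length ts))
  ts′ cs′ : List (ℕ × ℚ)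
  ts′ = labelsF m d acc ts
  cs′ = labelsF m (suc d) acc′ cs
  e₁ e₂ e₃ : ℕ
  e₁ = sizeF ts ℕ.+ e
  e₂ = sizeF cs ℕ.+ e₁
  e₃ = sizeF (node cs ∷ ts) ℕ.+ e
  rest : List ℕ
  rest = areaGo (d ℕ.+ e₃) e₃ w
  e₂+1≡e₃ : suc e₂ ≡ e₃
  e₂+1≡e₃ = cong suc (sym (ℕP.+-assoc (sizeF cs) (sizeF ts) e))
  climb : suc d ℕ.+ e₂ ≡ d ℕ.+ e₃
  climb = trans (sym (ℕP.+-suc d e₂)) (cong (d ℕ.+_) e₂+1≡e₃)

areaVector-steepF : ∀ m acc ts → areaVector (steepF ts) ≡ map proj₁ (labelsF m 0 acc ts)
areaVector-steepF m acc ts = begin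
  areaGo 0 0 (steepF ts)                ≡⟨ cong (areaGo 0 0) (++-identityʳ (steepF ts)) ⟨
  areaGo 0 0 (steepF ts ++ [])          ≡⟨ areaGo-steepF m 0 acc ts 0 [] ⟩
  map proj₁ (labelsF m 0 acc ts) ++ []  ≡⟨ ++-identityʳ _ ⟩
  map proj₁ (labelsF m 0 acc ts)        ∎
  where open ≡-Reasoning

childAcc-<-suc : ∀ m d acc k → childAcc m d acc k ℚ.< childAcc m d acc (suc k)
childAcc-<-suc m d acc k =
  ℚP.+-monoʳ-< acc (*<*⇒/</ k (weight m d) (suc k) (weight m d) (ℕP.*-monoˡ-< (weight m d) (ℕP.n<1+n k)))
  where
  instance
    W≢0 : NonZero (weight m d)
    W≢0 = weight-nonZero m d

acc<childAcc : ∀ m d acc k → acc ℚ.< childAcc m d acc (suc k)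
acc<childAcc m d acc k = begin-strict
  acc                       ≡⟨ ℚP.+-identityʳ acc ⟨
  acc ℚ.+ 0ℚ                <⟨ ℚP.+-monoʳ-< acc (*<*⇒/</ 0 1 (suc k) (weight m d) (s≤s z≤n)) ⟩
  childAcc m d acc (suc k)  ∎
  where
  open ℚP.≤-Reasoning
  instance
    W≢0 : NonZero (weight m d)
    W≢0 = weight-nonZero m d

-- The digits of a subtree add at most one unit of the parent's digit, since they are below m + 2.
childAcc-nested-≤ : ∀ m d acc k s → s ≤ 2 ℕ.+ m →
                    childAcc m (suc d) (childAcc m d acc k) s ℚ.≤ childAcc m d acc (suc k)
childAcc-nested-≤ m d acc k s s≤2+m = begin
  acc ℚ.+ + k / W ℚ.+ + s / W′    ≡⟨ ℚP.+-assoc acc (+ k / W) (+ s / W′) ⟩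
  acc ℚ.+ (+ k / W ℚ.+ + s / W′)  ≤⟨ ℚP.+-monoʳ-≤ acc (ℚP.+-monoʳ-≤ (+ k / W) s/W′≤1/W) ⟩
  acc ℚ.+ (+ k / W ℚ.+ + 1 / W)   ≡⟨ cong (acc ℚ.+_) (/+/≡/ k 1 W) ⟩
  acc ℚ.+ + (k ℕ.+ 1) / W         ≡⟨ cong (λ j → acc ℚ.+ + j / W) (ℕP.+-comm k 1) ⟩
  acc ℚ.+ + suc k / W             ∎
  where
  open ℚP.≤-Reasoning
  W W′ : ℕ
  W = weight m d
  W′ = weight m (suc d)
  instance
    W≢0 : NonZero W
    W≢0 = weight-nonZero m d
    W′≢0 : NonZero W′
    W′≢0 = weight-nonZero m (suc d)
  s/W′≤1/W : + s / W′ ℚ.≤ + 1 / W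
  s/W′≤1/W = *≤*⇒/≤/ s W′ 1 W (subst (s ℕ.* W ≤_) (sym (ℕP.*-identityˡ W′)) (ℕP.*-monoˡ-≤ W s≤2+m))

rootChildAcc-≤1 : ∀ m k → k ≤ 2 ℕ.+ m → childAcc m 0 0ℚ k ℚ.≤ 1ℚ
rootChildAcc-≤1 m k k≤2+m = begin
  0ℚ ℚ.+ + k / weight m 0  ≡⟨ ℚP.+-identityˡ _ ⟩
  + k / weight m 0         ≤⟨ *≤*⇒/≤/ k (weight m 0) 1 1 k*1≤1*W ⟩
  1ℚ                       ∎
  where
  open ℚP.≤-Reasoning
  instance
    W≢0 : NonZero (weight m 0)
    W≢0 = weight-nonZero m 0
  k*1≤1*W : k ℕ.* 1 ≤ 1 ℕ.* weight m 0
  k*1≤1*W rewrite ℕP.*-identityʳ k | ℕP.*-identityˡ (weight m 0) | ℕP.*-identityʳ (2 ℕ.+ m) = k≤2+m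

maxArity-split : ∀ {m} cs ts → maxArityT (node (node cs ∷ ts)) ≤ m →
                 maxArityT (node cs) ≤ m × maxArityT (node ts) ≤ m
maxArity-split {m} cs ts ≤m =
    ℕP.m⊔n≤o⇒m≤o (maxArityT (node cs)) (maxArityF ts) children≤m
  , ℕP.⊔-lub (ℕP.<⇒≤ (ℕP.m⊔n≤o⇒m≤o (suc (length ts)) (maxArityF (node cs ∷ ts)) ≤m))
             (ℕP.m⊔n≤o⇒n≤o (maxArityT (node cs)) (maxArityF ts) children≤m)
  where
  children≤m : maxArityF (node cs ∷ ts) ≤ m
  children≤m = ℕP.m⊔n≤o⇒n≤o (suc (length ts)) (maxArityF (node cs ∷ ts)) ≤m

length≤maxArity : ∀ {m} cs → maxArityT (node cs) ≤ m → length cs ≤ m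
length≤maxArity cs = ℕP.m⊔n≤o⇒m≤o (length cs) (maxArityF cs)

Between : ℚ → ℚ → ℚ → Set
Between lo hi x = lo ℚ.< x × x ℚ.< hi

labelsF-bounded : ∀ m d acc ts → maxArityT (node ts) ≤ m →
                  All (Between acc (childAcc m d acc (suc (length ts))) ∘ proj₂) (labelsF m d acc ts)
labelsF-bounded m d acc []             _  = []
labelsF-bounded m d acc (node cs ∷ ts) ≤m =
  All.++⁺ (All.map (λ (lo , hi) → lo , ℚP.<-trans hi acc′<U) (labelsF-bounded m d acc ts ts≤m))
          ((acc<acc′ , acc′<U)
            ∷ All.map (λ (lo , hi) → ℚP.<-trans acc<acc′ lo , ℚP.<-≤-trans hi cs-top≤U)
                      (labelsF-bounded m (suc d) acc′ cs cs≤m))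
  where
  acc′ U : ℚ
  acc′ = childAcc m d acc (suc (length ts))
  U = childAcc m d acc (suc (suc (length ts)))
  cs≤m : maxArityT (node cs) ≤ m
  cs≤m = proj₁ (maxArity-split cs ts ≤m)
  ts≤m : maxArityT (node ts) ≤ m
  ts≤m = proj₂ (maxArity-split cs ts ≤m)
  acc<acc′ : acc ℚ.< acc′
  acc<acc′ = acc<childAcc m d acc (length ts)
  acc′<U : acc′ ℚ.< U
  acc′<U = childAcc-<-suc m d acc (suc (length ts))
  cs-top≤U : childAcc m (suc d) acc′ (suc (length cs)) ℚ.≤ U
  cs-top≤U = childAcc-nested-≤ m d acc (suc (length ts)) (suc (length cs))
               (ℕP.m≤n⇒m≤1+n (s≤s (length≤maxArity cs cs≤m)))

labelsF-increasing : ∀ m d acc ts → maxArityT (node ts) ≤ m → AllPairs (ℚ._<_ on proj₂) (labelsF m d acc ts)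
labelsF-increasing m d acc []             _  = []
labelsF-increasing m d acc (node cs ∷ ts) ≤m =
  AllPairs.++⁺ (labelsF-increasing m d acc ts ts≤m)
               (All.map proj₁ cs-bounds ∷ labelsF-increasing m (suc d) acc′ cs cs≤m)
               (All.map (λ (_ , x<acc′) → x<acc′ ∷ All.map (λ (acc′<y , _) → ℚP.<-trans x<acc′ acc′<y) cs-bounds)
                        (labelsF-bounded m d acc ts ts≤m))
  where
  acc′ : ℚ
  acc′ = childAcc m d acc (suc (length ts))
  cs≤m : maxArityT (node cs) ≤ m
  cs≤m = proj₁ (maxArity-split cs ts ≤m)
  ts≤m : maxArityT (node ts) ≤ m
  ts≤m = proj₂ (maxArity-split cs ts ≤m)
  cs-bounds : All (Between acc′ (childAcc m (suc d) acc′ (suc (length cs))) ∘ proj₂) (labelsF m (suc d) acc′ cs)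
  cs-bounds = labelsF-bounded m (suc d) acc′ cs cs≤m

labelsF-fracs : ∀ m cs → maxArityT (node cs) ≤ m → All (Frac ∘ proj₂) (labelsF m 0 0ℚ cs)
labelsF-fracs m cs ≤m = All.map (λ (lo , hi) → ℚP.<⇒≤ lo , ℚP.<-≤-trans hi top≤1) (labelsF-bounded m 0 0ℚ cs ≤m)
  where
  top≤1 : childAcc m 0 0ℚ (suc (length cs)) ℚ.≤ 1ℚ
  top≤1 = rootChildAcc-≤1 m (suc (length cs)) (ℕP.m≤n⇒m≤1+n (s≤s (length≤maxArity cs ≤m)))

proposition4p5 : ∀ (n : ℕ) → 1 ≤ n → (D : List Step) → IsDyck n D →
                 (T : Tree) → Ξsteep T ≡ D →
                 PosetIso n (ψ≼ D) (Ξposet≼ T)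
proposition4p5 n _ .(steepF cs) D-dyck (node cs) refl =
  subst₂ (λ k A → PosetIso k (areaOrder≼ A) (unitIntervalOrder≼ (sortedCoords (node cs)))) size (sym areas)
    (labels-PosetIso P (labelsF-fracs m cs ℕP.≤-refl) (labelsF-increasing m 0 0ℚ cs ℕP.≤-refl) P↭S)
  where
  m : ℕ
  m = maxArityT (node cs)
  P : List (ℕ × ℚ)
  P = labelsF m 0 0ℚ cs
  areas : areaVector (steepF cs) ≡ map proj₁ P
  areas = areaVector-steepF m 0ℚ cs
  size : length P ≡ n
  size = begin
    length P                          ≡⟨ length-map proj₁ P ⟨
    length (map proj₁ P)              ≡⟨ cong length areas ⟨
    length (areaVector (steepF cs))   ≡⟨ length-areaGo 0 0 (steepF cs) ⟩
    countN (steepF cs)                ≡⟨ IsDyck.northSteps D-dyck ⟩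
    n                                 ∎
    where open ≡-Reasoning
  P↭S : map coordinate P ↭ sortedCoords (node cs)
  P↭S = ↭-trans (labelsF-coords-↭ m 0 0ℚ cs) (↭-sym (sort-↭ (coords (node cs))))
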